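{- Let $p$ be a positive integer and $G$ a finite simple graph with at least one edge and minimum degree $\delta(G)$. If $\delta(G)<p$, then $r_p(G)\le\delta(G)+p$.
   Context: For a graph $G=(V,E)$, a set $D\subseteq V$ is a $p$-dominating set if every vertex $x\notin D$ has at least $p$ neighbours in $D$; $\gamma_p(G)$ is the minimum size of a $p$-dominating set. For $B\subseteq E(G^c)$ (edges of the complement), $G+B=(V,E\cup B)$. The $p$-reinforcement number is $r_p(G)=\min\{|B| : B\subseteq E(G^c),\ \gamma_p(G+B)<\gamma_p(G)\}$, with the convention $r_p(G)=0$ if $\gamma_p(G)\le p$. -}

module Defs where

open import Data.Bool using (Bool; true; false; _∧_; _∨_)
open import Data.Nat using (ℕ; _≤_; _<_; _<ᵇ_)
open import Data.Fin using (Fin; toℕ)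
open import Data.Fin.Subset using (Subset; _∉_; _∩_; ∣_∣)
open import Data.Vec using (tabulate)
open import Data.List using (map)
open import Data.Nat.ListAction using (sum)
open import Data.List using () renaming (allFin to allFinL)
open import Data.Product using (Σ; ∃; _×_)
open import Data.Sum using (_⊎_)
open import Relation.Binary.PropositionalEquality using (_≡_; refl)

record Graph (n : ℕ) : Set where
  field
    adj   : Fin n → Fin n → Bool
    sym   : ∀ x y → adj x y ≡ adj y x
    irrefl : ∀ x → adj x x ≡ false
open Graph public

N : ∀ {n} → Graph n → Fin n → Subset n
N G x = tabulate (adj G x)

deg : ∀ {n} → Graph n → Fin n → ℕ
deg G x = ∣ N G x ∣

IsMinDegree : ∀ {n} → Graph n → ℕ → Set
IsMinDegree G d = (∃ λ x → deg G x ≡ d) × (∀ x → d ≤ deg G x)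

HasEdge : ∀ {n} → Graph n → Set
HasEdge G = ∃ λ x → ∃ λ y → adj G x y ≡ true

edgeCount : ∀ {n} → Graph n → ℕ
edgeCount {n} G = sum (map (λ x → ∣ tabulate (λ y → adj G x y ∧ (toℕ x <ᵇ toℕ y)) ∣) (allFinL n))

NonEdgesOf : ∀ {n} → Graph n → Graph n → Set
NonEdgesOf G B = ∀ x y → adj B x y ≡ true → adj G x y ≡ false

_⊕_ : ∀ {n} → Graph n → Graph n → Graph n
adj    (G ⊕ B) x y = adj G x y ∨ adj B x y
sym    (G ⊕ B) x y rewrite Graph.sym G x y | Graph.sym B x y = refl
irrefl (G ⊕ B) x rewrite Graph.irrefl G x | Graph.irrefl B x = refl

PDominating : ∀ {n} → ℕ → Graph n → Subset n → Set
PDominating p G D = ∀ x → x ∉ D → p ≤ ∣ D ∩ N G x ∣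

IsGammaP : ∀ {n} → ℕ → Graph n → ℕ → Set
IsGammaP p G k =
  (∃ λ D → PDominating p G D × ∣ D ∣ ≡ k) ×
  (∀ D → PDominating p G D → k ≤ ∣ D ∣)

Reinforces : ∀ {n} → ℕ → Graph n → ℕ → Graph n → Set
Reinforces p G γ B = NonEdgesOf G B × (∃ λ γ' → IsGammaP p (G ⊕ B) γ' × γ' < γ)

-- r_p(G) = r  (with the convention r_p(G) = 0 when γ_p(G) ≤ p)
IsReinfP : ∀ {n} → ℕ → Graph n → ℕ → Set
IsReinfP p G r = ∃ λ γ → IsGammaP p G γ ×
  ( (γ ≤ p × r ≡ 0)
  ⊎ (p < γ × (∃ λ B → Reinforces p G γ B × edgeCount B ≡ r)
           × (∀ B → Reinforces p G γ B → r ≤ edgeCount B)))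

module Submission where

-- If γ_p(G) ≤ p then r_p(G) = 0 by convention.  Otherwise let D be a
-- minimum p-dominating set and v a vertex of minimum degree δ < p; v cannot
-- be p-dominated, so v ∈ D.  Put D' = D ∖ {v} (so |D'| ≥ p) and fix P ⊆ D'
-- with |P| = p.  Adding the edges from v to P and, for every x ∉ D adjacent
-- to v, one edge from x to a vertex of D' it misses, makes D' p-dominating;
-- this adds at most p + δ edges and lowers γ_p, hence r_p(G) ≤ δ + p.

open import Defs hiding (sym)
open import Data.Nat using (ℕ; zero; suc; _+_; _*_; _≤_; _<_; z≤n; s≤s; s≤s⁻¹; _<ᵇ_; _≤?_; _<?_)
open import Data.Nat.Properties
open import Data.Nat.ListAction using () renaming (sum to sumL)
open import Algebra.Properties.CommutativeMonoid.Sum +-0-commutativeMonoid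
  using (sum; sum-syntax; ∑-distrib-+; ∑-comm; sum-cong-≗; sum-replicate-zero)
open import Algebra.Properties.Semiring.Sum +-*-semiring using (*-distribʳ-sum)
open import Algebra.Properties.CommutativeSemigroup +-commutativeSemigroup using (x∙yz≈y∙xz)
open import Data.Bool using (Bool; true; false; _∧_; _∨_; not)
open import Data.Bool.Properties
  using (∧-zeroʳ; ∧-identityʳ; ∧-inverseʳ; ∧-conicalˡ; ∧-conicalʳ; ∨-comm; ∨-idem)
  renaming (_≟_ to _≟ᵇ_)
open import Data.Fin using (Fin; zero; suc; toℕ)
open import Data.Fin.Properties using (all?; any?) renaming (_≟_ to _≟ᶠ_)
open import Data.Fin.Subset using (Subset; _∈_; _∉_; _∩_; ∣_∣; ⊤)
open import Data.Fin.Subset.Properties using (anySubset?; _∈?_; ∈⊤; p∩q⊆q; p⊆q⇒∣p∣≤∣q∣)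
open import Data.Vec using (Vec; []; _∷_; lookup; tabulate)
open import Data.Vec.Properties using (lookup∘tabulate; lookup-zipWith; tabulate-cong; []=⇒lookup; lookup⇒[]=)
open import Data.List using (map) renaming (allFin to allFinL; tabulate to tabulateL)
open import Data.Product using (∃; _×_; _,_; proj₁; proj₂)
open import Data.Sum using (_⊎_; inj₁; inj₂)
open import Data.Empty using (⊥-elim)
open import Relation.Nullary using (¬_; Dec; yes; no; does)
open import Relation.Nullary.Decidable using (dec-true; dec-false; _×-dec_; _→-dec_; ¬?)
open import Relation.Binary.PropositionalEquality
  using (_≡_; _≢_; refl; sym; trans; cong; cong₂; subst; module ≡-Reasoning)


∧-intro : ∀ {a b} → a ≡ true → b ≡ true → a ∧ b ≡ true
∧-intro refl refl = refl

∨-introˡ : ∀ {a} b → a ≡ true → a ∨ b ≡ true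
∨-introˡ b refl = refl

∨-introʳ : ∀ a {b} → b ≡ true → a ∨ b ≡ true
∨-introʳ true  _ = refl
∨-introʳ false e = e

∨-elim : ∀ a b → a ∨ b ≡ true → a ≡ true ⊎ b ≡ true
∨-elim true  b _ = inj₁ refl
∨-elim false b e = inj₂ e

boolean : ∀ b → b ≡ true ⊎ b ≡ false
boolean true  = inj₁ refl
boolean false = inj₂ refl

not-true : ∀ {b} → not b ≡ true → b ≡ false
not-true {false} _ = refl

true≢false : ∀ {b} → b ≡ true → b ≢ false
true≢false refl ()

_==_ : ∀ {n} → Fin n → Fin n → Bool
x == y = does (x ≟ᶠ y)

==-refl : ∀ {n} (x : Fin n) → (x == x) ≡ true
==-refl x = dec-true (x ≟ᶠ x) refl

==-sym : ∀ {n} (x y : Fin n) → (x == y) ≡ (y == x)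
==-sym x y with x ≟ᶠ y
... | yes refl = sym (==-refl x)
... | no x≢y   = sym (dec-false (y ≟ᶠ x) (λ y≡x → x≢y (sym y≡x)))

==⇒≡ : ∀ {n} (x y : Fin n) → (x == y) ≡ true → x ≡ y
==⇒≡ x y e with x ≟ᶠ y
==⇒≡ x y _  | yes x≡y = x≡y
==⇒≡ x y () | no _

≢⇒==false : ∀ {n} {x y : Fin n} → x ≢ y → (x == y) ≡ false
≢⇒==false {x = x} {y} = dec-false (x ≟ᶠ y)


[_] : Bool → ℕ
[ true ]  = 1
[ false ] = 0

count : ∀ {n} → (Fin n → Bool) → ℕ
count {n} P = ∑[ y < n ] [ P y ]

_⊆ᵇ_ : ∀ {n} → (Fin n → Bool) → (Fin n → Bool) → Set
P ⊆ᵇ Q = ∀ y → P y ≡ true → Q y ≡ true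

_∖_ : ∀ {n} → (Fin n → Bool) → Fin n → (Fin n → Bool)
(P ∖ v) y = P y ∧ not (y == v)

∑-mono : ∀ {n} {f g : Fin n → ℕ} → (∀ i → f i ≤ g i) → sum f ≤ sum g
∑-mono {zero}  f≤g = z≤n
∑-mono {suc n} f≤g = +-mono-≤ (f≤g zero) (∑-mono (λ i → f≤g (suc i)))

count-cong : ∀ {n} {P Q : Fin n → Bool} → (∀ y → P y ≡ Q y) → count P ≡ count Q
count-cong P≡Q = sum-cong-≗ (λ y → cong [_] (P≡Q y))

[]-mono : ∀ {a b} → (a ≡ true → b ≡ true) → [ a ] ≤ [ b ]
[]-mono {true}  a⇒b rewrite a⇒b refl = ≤-refl
[]-mono {false} a⇒b = z≤n

count-mono : ∀ {n} {P Q : Fin n → Bool} → P ⊆ᵇ Q → count P ≤ count Q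
count-mono P⊆Q = ∑-mono (λ y → []-mono (P⊆Q y))

count-none : ∀ n → count {n} (λ _ → false) ≡ 0
count-none n = sum-replicate-zero n

count-remove : ∀ {n} (P : Fin n → Bool) v → count P ≡ [ P v ] + count (P ∖ v)
count-remove {suc n} P zero = cong ([ P zero ] +_) (sym (cong₂ _+_
  (cong [_] (∧-zeroʳ (P zero)))
  (count-cong (λ y → ∧-identityʳ (P (suc y))))))
count-remove {suc n} P (suc v) = begin
  [ P zero ] + count (λ y → P (suc y))
    ≡⟨ cong ([ P zero ] +_) (count-remove (λ y → P (suc y)) v) ⟩
  [ P zero ] + ([ P (suc v) ] + count ((λ y → P (suc y)) ∖ v))
    ≡⟨ x∙yz≈y∙xz [ P zero ] [ P (suc v) ] (count ((λ y → P (suc y)) ∖ v)) ⟩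
  [ P (suc v) ] + ([ P zero ] + count ((λ y → P (suc y)) ∖ v))
    ≡⟨ cong (λ b → [ P (suc v) ] + ([ b ] + count ((λ y → P (suc y)) ∖ v))) (sym (∧-identityʳ (P zero))) ⟩
  [ P (suc v) ] + count (P ∖ suc v) ∎
  where open ≡-Reasoning

count-singleton : ∀ {n} (v : Fin n) → count (_== v) ≡ 1
count-singleton {n} v = begin
  count (_== v)                     ≡⟨ count-remove (_== v) v ⟩
  [ v == v ] + count ((_== v) ∖ v)   ≡⟨ cong₂ _+_ (cong [_] (==-refl v)) (count-cong (λ y → ∧-inverseʳ (y == v))) ⟩
  1 + count {n} (λ _ → false)        ≡⟨ cong suc (count-none n) ⟩
  1 ∎
  where open ≡-Reasoning

[∨]≤ : ∀ a b → [ a ∨ b ] ≤ [ a ] + [ b ]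
[∨]≤ true  b = s≤s z≤n
[∨]≤ false b = ≤-refl

count-∨ : ∀ {n} (P Q : Fin n → Bool) → count (λ y → P y ∨ Q y) ≤ count P + count Q
count-∨ P Q = begin
  count (λ y → P y ∨ Q y)          ≤⟨ ∑-mono (λ y → [∨]≤ (P y) (Q y)) ⟩
  sum (λ y → [ P y ] + [ Q y ])    ≡⟨ ∑-distrib-+ (λ y → [ P y ]) (λ y → [ Q y ]) ⟩
  count P + count Q ∎
  where open ≤-Reasoning

takeSubset : ∀ {n} (P : Fin n → Bool) k → k ≤ count P → ∃ λ Q → Q ⊆ᵇ P × count Q ≡ k
takeSubset {zero} P zero _ = (λ ()) , (λ ()) , refl
takeSubset {suc n} P k k≤ with P zero in P₀
takeSubset {suc n} P zero _ | true = (λ _ → false) , (λ _ ()) , count-none (suc n)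
takeSubset {suc n} P (suc k) (s≤s k≤) | true with takeSubset (λ y → P (suc y)) k k≤
... | Q , Q⊆P , #Q = (λ { zero → true ; (suc y) → Q y }) , (λ { zero _ → P₀ ; (suc y) → Q⊆P y }) , cong suc #Q
takeSubset {suc n} P k k≤ | false with takeSubset (λ y → P (suc y)) k k≤
... | Q , Q⊆P , #Q = (λ { zero → false ; (suc y) → Q y }) , (λ { zero () ; (suc y) → Q⊆P y }) , #Q


count-guard : ∀ {n} c (Q : Fin n → Bool) {k} → count Q ≤ k → count (λ y → c ∧ Q y) ≤ [ c ] * k
count-guard true  Q {k} #Q≤k = subst (count Q ≤_) (sym (+-identityʳ k)) #Q≤k
count-guard {n} false Q {k} _ = ≤-reflexive (count-none n)

∑-*ʳ : ∀ {n} (f : Fin n → ℕ) c → ∑[ x < n ] (f x * c) ≡ sum f * c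
∑-*ʳ f c = sym (*-distribʳ-sum c f)

count-exchange : ∀ {n} (P : Fin n → Bool) v w → P v ≡ true → P w ≡ false →
                 count P ≤ count (λ y → (P ∖ v) y ∨ (y == w))
count-exchange {n} P v w Pv Pw = begin
  count P                    ≡⟨ count-remove P v ⟩
  [ P v ] + count (P ∖ v)    ≤⟨ +-mono-≤ (≤-reflexive (cong [_] (trans Pv (sym Qw)))) (count-mono kept) ⟩
  [ Q w ] + count (Q ∖ w)    ≡⟨ count-remove Q w ⟨
  count Q ∎
  where
  open ≤-Reasoning
  Q : Fin n → Bool
  Q y = (P ∖ v) y ∨ (y == w)
  Qw : Q w ≡ true
  Qw = ∨-introʳ ((P ∖ v) w) (==-refl w)
  kept : (P ∖ v) ⊆ᵇ (Q ∖ w)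
  kept y Py∖v = ∧-intro (∨-introˡ (y == w) Py∖v) (cong not (≢⇒==false y≢w))
    where
    y≢w : y ≢ w
    y≢w refl = true≢false (∧-conicalˡ (P y) _ Py∖v) Pw


count-disjoint : ∀ {n} (P a b : Fin n → Bool) → (∀ y → a y ≡ true → b y ≡ false) →
                 count (λ y → P y ∧ a y) + count (λ y → P y ∧ b y) ≤ count P
count-disjoint P a b disjoint = begin
  count (λ y → P y ∧ a y) + count (λ y → P y ∧ b y)  ≡⟨ ∑-distrib-+ (λ y → [ P y ∧ a y ]) (λ y → [ P y ∧ b y ]) ⟨
  sum (λ y → [ P y ∧ a y ] + [ P y ∧ b y ])          ≤⟨ ∑-mono (λ y → pointwise (P y) (a y) (b y) (disjoint y)) ⟩
  count P ∎
  where
  open ≤-Reasoning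
  pointwise : ∀ h c d → (c ≡ true → d ≡ false) → [ h ∧ c ] + [ h ∧ d ] ≤ [ h ]
  pointwise false c     d     _  = z≤n
  pointwise true  true  d     c⇒¬d rewrite c⇒¬d refl = ≤-refl
  pointwise true  false true  _  = ≤-refl
  pointwise true  false false _  = z≤n


card-count : ∀ {n} (S : Subset n) → ∣ S ∣ ≡ count (lookup S)
card-count []          = refl
card-count (true ∷ S)  = cong suc (card-count S)
card-count (false ∷ S) = card-count S

card-tabulate : ∀ {n} (P : Fin n → Bool) → ∣ tabulate P ∣ ≡ count P
card-tabulate P = trans (card-count (tabulate P)) (count-cong (lookup∘tabulate P))

card-∩N : ∀ {n} (S : Subset n) (H : Graph n) x → ∣ S ∩ N H x ∣ ≡ count (λ y → lookup S y ∧ adj H x y)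
card-∩N S H x = trans (card-count (S ∩ N H x)) (count-cong (λ y →
  trans (lookup-zipWith _∧_ y S (N H x)) (cong (lookup S y ∧_) (lookup∘tabulate (adj H x) y))))

sumL-allFin : ∀ {n} (f : Fin n → ℕ) → sumL (map f (allFinL n)) ≡ sum f
sumL-allFin {n} f = sum-tabulate (λ i → i)
  where
  sum-tabulate : ∀ {k} (g : Fin k → Fin n) → sumL (map f (tabulateL g)) ≡ sum (λ i → f (g i))
  sum-tabulate {zero}  g = refl
  sum-tabulate {suc k} g = cong (f (g zero) +_) (sum-tabulate (λ i → g (suc i)))

edgeCount-count : ∀ {n} (H : Graph n) →
                  edgeCount H ≡ ∑[ x < n ] count (λ y → adj H x y ∧ (toℕ x <ᵇ toℕ y))
edgeCount-count {n} H =
  trans (sumL-allFin {n} (λ x → ∣ tabulate (λ y → adj H x y ∧ (toℕ x <ᵇ toℕ y)) ∣))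
        (sum-cong-≗ (λ x → card-tabulate (λ y → adj H x y ∧ (toℕ x <ᵇ toℕ y))))


∉⇒lookup : ∀ {n} {S : Subset n} {x} → x ∉ S → lookup S x ≡ false
∉⇒lookup {S = S} {x} x∉S with lookup S x in Sx
... | true  = ⊥-elim (x∉S (lookup⇒[]= x S Sx))
... | false = refl

lookup⇒∉ : ∀ {n} {S : Subset n} {x} → lookup S x ≡ false → x ∉ S
lookup⇒∉ Sx x∈S = true≢false ([]=⇒lookup x∈S) Sx


Least : (ℕ → Set) → ℕ → Set
Least Q k = Q k × (∀ j → Q j → k ≤ j)

search : {Q : ℕ → Set} → (∀ k → Dec (Q k)) → ∀ m → (∃ (Least Q)) ⊎ (∀ j → j ≤ m → ¬ Q j)
search Q? zero with Q? zero
... | yes q  = inj₁ (zero , q , λ _ _ → z≤n)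
... | no ¬q = inj₂ λ { zero z≤n → ¬q }
search {Q} Q? (suc m) with search Q? m
... | inj₁ found = inj₁ found
... | inj₂ none with Q? (suc m)
...   | yes q  = inj₁ (suc m , q , λ j qj → ≰⇒> (λ j≤m → none j j≤m qj))
...   | no ¬q = inj₂ λ j j≤1+m → case-≤ j (m≤n⇒m<n∨m≡n j≤1+m)
  where
  case-≤ : ∀ j → j < suc m ⊎ j ≡ suc m → ¬ Q j
  case-≤ j (inj₁ (s≤s j≤m)) = none j j≤m
  case-≤ j (inj₂ refl)      = ¬q

least : {Q : ℕ → Set} → (∀ k → Dec (Q k)) → ∀ m → Q m → ∃ (Least Q)
least Q? m qm with search Q? m
... | inj₁ found = found
... | inj₂ none  = ⊥-elim (none m ≤-refl qm)

-- p-domination is decidable, so γ_p exists (the whole vertex set is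
-- p-dominating) and is unique.
pDominating? : ∀ {n} p (G : Graph n) D → Dec (PDominating p G D)
pDominating? p G D = all? (λ x → ¬? (x ∈? D) →-dec (p ≤? ∣ D ∩ N G x ∣))

γ-exists : ∀ {n} p (G : Graph n) → ∃ (IsGammaP p G)
γ-exists {n} p G with least size? ∣ ⊤ {n} ∣ (⊤ , (λ x x∉⊤ → ⊥-elim (x∉⊤ ∈⊤)) , refl)
  where
  size? : ∀ k → Dec (∃ λ D → PDominating p G D × ∣ D ∣ ≡ k)
  size? k = anySubset? (λ D → pDominating? p G D ×-dec (∣ D ∣ ≟ k))
... | k , witness , minimal = k , witness , λ D dom → minimal ∣ D ∣ (D , dom , refl)

γ-unique : ∀ {n} p (G : Graph n) {a b} → IsGammaP p G a → IsGammaP p G b → a ≡ b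
γ-unique p G ((Da , da , ∣Da∣) , mina) ((Db , db , ∣Db∣) , minb) =
  ≤-antisym (subst (_ ≤_) ∣Db∣ (mina Db db)) (subst (_ ≤_) ∣Da∣ (minb Da da))


_≈G_ : ∀ {n} → Graph n → Graph n → Set
B ≈G B' = ∀ x y → adj B x y ≡ adj B' x y

graphOf : ∀ {n} → (Fin n → Fin n → Bool) → Graph n
graphOf M = record
  { adj    = λ x y → not (x == y) ∧ (M x y ∨ M y x)
  ; sym    = λ x y → cong₂ (λ e m → not e ∧ m) (==-sym x y) (∨-comm (M x y) (M y x))
  ; irrefl = λ x → cong (λ e → not e ∧ (M x x ∨ M x x)) (==-refl x)
  }

graphOf-adj : ∀ {n} (B : Graph n) → graphOf (adj B) ≈G B
graphOf-adj B x y with x ≟ᶠ y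
... | yes refl = sym (irrefl B x)
... | no _     = trans (cong (adj B x y ∨_) (Graph.sym B y x)) (∨-idem (adj B x y))

graphOf-cong : ∀ {n} {M M' : Fin n → Fin n → Bool} → (∀ x y → M x y ≡ M' x y) → graphOf M ≈G graphOf M'
graphOf-cong M≡M' x y = cong (not (x == y) ∧_) (cong₂ _∨_ (M≡M' x y) (M≡M' y x))


graphOf-⊇ : ∀ {n} (H : Fin n → Fin n → Bool) {x y} → x ≢ y → H x y ≡ true → adj (graphOf H) x y ≡ true
graphOf-⊇ H {x} {y} x≢y Hxy = ∧-intro (cong not (≢⇒==false x≢y)) (∨-introˡ (H y x) Hxy)

graphOf-nonEdges : ∀ {n} (G : Graph n) (H : Fin n → Fin n → Bool) →
                   (∀ x y → H x y ≡ true → adj G x y ≡ false) → NonEdgesOf G (graphOf H)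
graphOf-nonEdges G H nonAdj x y e with ∨-elim (H x y) (H y x) (∧-conicalʳ (not (x == y)) _ e)
... | inj₁ Hxy = nonAdj x y Hxy
... | inj₂ Hyx = trans (Graph.sym G x y) (nonAdj y x Hyx)


pairCount : ∀ {n} → (Fin n → Fin n → Bool) → ℕ
pairCount {n} H = ∑[ x < n ] count (H x)

-- The strict order is asymmetric, so no pair is counted in both directions.
<ᵇ-asym : ∀ m n → (m <ᵇ n) ≡ true → (n <ᵇ m) ≡ false
<ᵇ-asym zero    (suc n) _ = refl
<ᵇ-asym (suc m) (suc n) m<n = <ᵇ-asym m n m<n


edge-origin : ∀ e h h' l → (not e ∧ (h ∨ h')) ∧ l ≡ true → (h ∧ l) ∨ (h' ∧ l) ≡ true
edge-origin false true  h'    true  _ = refl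
edge-origin false false true  true  _ = refl
edge-origin true  _     _     _     ()
edge-origin false false false _     ()
edge-origin false true  _     false ()
edge-origin false false true  false ()

edgeCount-graphOf : ∀ {n} (H : Fin n → Fin n → Bool) → edgeCount (graphOf H) ≤ pairCount H
edgeCount-graphOf {n} H = begin
  edgeCount (graphOf H)
    ≡⟨ edgeCount-count (graphOf H) ⟩
  ∑[ x < n ] count (λ y → (not (x == y) ∧ (H x y ∨ H y x)) ∧ lt x y)
    ≤⟨ ∑-mono (λ x → ≤-trans (count-mono (λ y → edge-origin (x == y) (H x y) (H y x) (lt x y)))
                             (count-∨ (λ y → H x y ∧ lt x y) (λ y → H y x ∧ lt x y))) ⟩
  ∑[ x < n ] (count (λ y → H x y ∧ lt x y) + count (λ y → H y x ∧ lt x y))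
    ≡⟨ ∑-distrib-+ (λ x → count (λ y → H x y ∧ lt x y)) (λ x → count (λ y → H y x ∧ lt x y)) ⟩
  ∑[ x < n ] count (λ y → H x y ∧ lt x y) + ∑[ x < n ] count (λ y → H y x ∧ lt x y)
    ≡⟨ cong (∑[ x < n ] count (λ y → H x y ∧ lt x y) +_) (∑-comm (λ x y → [ H y x ∧ lt x y ])) ⟩
  ∑[ x < n ] count (λ y → H x y ∧ lt x y) + ∑[ x < n ] count (λ y → H x y ∧ lt y x)
    ≡⟨ ∑-distrib-+ (λ x → count (λ y → H x y ∧ lt x y)) (λ x → count (λ y → H x y ∧ lt y x)) ⟨
  ∑[ x < n ] (count (λ y → H x y ∧ lt x y) + count (λ y → H x y ∧ lt y x))
    ≤⟨ ∑-mono (λ x → count-disjoint (H x) (lt x) (λ y → lt y x) (λ y → <ᵇ-asym (toℕ x) (toℕ y))) ⟩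
  pairCount H ∎
  where
  open ≤-Reasoning
  lt : Fin n → Fin n → Bool
  lt x y = toℕ x <ᵇ toℕ y


∃-vec? : {A : Set} → (∀ {Q : A → Set} → (∀ a → Dec (Q a)) → Dec (∃ Q)) →
         ∀ m {Q : Vec A m → Set} → (∀ v → Dec (Q v)) → Dec (∃ Q)
∃-vec? ∃A? zero Q? with Q? []
... | yes q  = yes ([] , q)
... | no ¬q = no λ { ([] , q) → ¬q q }
∃-vec? ∃A? (suc m) {Q} Q? with ∃A? (λ a → ∃-vec? ∃A? m (λ v → Q? (a ∷ v)))
... | yes (a , v , q) = yes (a ∷ v , q)
... | no ¬q          = no λ { (a ∷ v , q) → ¬q (a , v , q) }

matrix : ∀ {n} → Vec (Subset n) n → Fin n → Fin n → Bool
matrix rows x y = lookup (lookup rows x) y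

rowsOf : ∀ {n} → Graph n → Vec (Subset n) n
rowsOf B = tabulate (λ x → tabulate (adj B x))

graphOf-rowsOf : ∀ {n} (B : Graph n) → graphOf (matrix (rowsOf B)) ≈G B
graphOf-rowsOf B x y = trans (graphOf-cong entries x y) (graphOf-adj B x y)
  where
  entries : ∀ x y → matrix (rowsOf B) x y ≡ adj B x y
  entries x y = trans (cong (λ r → lookup r y) (lookup∘tabulate (λ x → tabulate (adj B x)) x))
                      (lookup∘tabulate (adj B x) y)

-- Whether some graph has a property depending only on adjacency is decidable:
-- it suffices to search through all vectors of n rows.
∃-graph? : ∀ {n} {P : Graph n → Set} → (∀ B B' → B ≈G B' → P B → P B') →
           (∀ B → Dec (P B)) → Dec (∃ P)
∃-graph? {n} resp P? with ∃-vec? anySubset? n (λ rows → P? (graphOf (matrix rows)))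
... | yes (rows , q) = yes (graphOf (matrix rows) , q)
... | no ¬q          = no λ { (B , q) →
        ¬q (rowsOf B , resp B (graphOf (matrix (rowsOf B))) (λ x y → sym (graphOf-rowsOf B x y)) q) }

SameNeighbourhoods : ∀ {n} → Graph n → Graph n → Set
SameNeighbourhoods H H' = ∀ x → N H x ≡ N H' x

pDominating-resp : ∀ {n} p (H H' : Graph n) → SameNeighbourhoods H H' →
                   ∀ D → PDominating p H D → PDominating p H' D
pDominating-resp p H H' same D dom x x∉D = subst (λ S → p ≤ ∣ D ∩ S ∣) (same x) (dom x x∉D)

γ-resp : ∀ {n} p (H H' : Graph n) {k} → SameNeighbourhoods H H' → IsGammaP p H k → IsGammaP p H' k
γ-resp p H H' same ((D , dom , ∣D∣) , minimal) =
  (D , pDominating-resp p H H' same D dom , ∣D∣) ,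
  λ D' dom' → minimal D' (pDominating-resp p H' H (λ x → sym (same x)) D' dom')

⊕-resp : ∀ {n} (G B B' : Graph n) → B ≈G B' → SameNeighbourhoods (G ⊕ B) (G ⊕ B')
⊕-resp G B B' B≈B' x = tabulate-cong (λ y → cong (adj G x y ∨_) (B≈B' x y))

reinforces-resp : ∀ {n} p (G : Graph n) γ (B B' : Graph n) → B ≈G B' → Reinforces p G γ B → Reinforces p G γ B'
reinforces-resp p G γ B B' B≈B' (nonEdges , γ' , isγ' , γ'<γ) =
  (λ x y b → nonEdges x y (trans (B≈B' x y) b)) , γ' ,
  γ-resp p (G ⊕ B) (G ⊕ B') (⊕-resp G B B' B≈B') isγ' , γ'<γ

edgeCount-resp : ∀ {n} (B B' : Graph n) → B ≈G B' → edgeCount B ≡ edgeCount B'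
edgeCount-resp B B' B≈B' = trans (edgeCount-count B) (trans
  (sum-cong-≗ (λ x → count-cong (λ y → cong (_∧ _) (B≈B' x y))))
  (sym (edgeCount-count B')))

reinforces? : ∀ {n} p (G : Graph n) γ B → Dec (Reinforces p G γ B)
reinforces? p G γ B = nonEdges? ×-dec smaller?
  where
  nonEdges? : Dec (NonEdgesOf G B)
  nonEdges? = all? (λ x → all? (λ y → (adj B x y ≟ᵇ true) →-dec (adj G x y ≟ᵇ false)))
  smaller? : Dec (∃ λ γ' → IsGammaP p (G ⊕ B) γ' × γ' < γ)
  smaller? with γ-exists p (G ⊕ B)
  ... | γB , isγB with γB <? γ
  ...   | yes γB<γ = yes (γB , isγB , γB<γ)
  ...   | no γB≮γ  = no λ { (γ' , isγ' , γ'<γ) →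
                       γB≮γ (subst (_< γ) (γ-unique p (G ⊕ B) isγ' isγB) γ'<γ) }

-- When γ_p(G) > p, every reinforcing B bounds r_p(G) by its number of edges:
-- the least size of a reinforcing set exists because it is decidable
-- whether one of size k exists.
reinforcement-bound : ∀ {n} p (G : Graph n) γ → IsGammaP p G γ → p < γ →
                      ∀ B → Reinforces p G γ B → ∃ λ r → IsReinfP p G r × r ≤ edgeCount B
reinforcement-bound p G γ isγ p<γ B reinforcesB
  with least size? (edgeCount B) (B , reinforcesB , refl)
  where
  size? : ∀ k → Dec (∃ λ B' → Reinforces p G γ B' × edgeCount B' ≡ k)
  size? k = ∃-graph? (λ B₁ B₂ B₁≈B₂ (r , e) → reinforces-resp p G γ B₁ B₂ B₁≈B₂ r ,
                                              trans (sym (edgeCount-resp B₁ B₂ B₁≈B₂)) e)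
                     (λ B' → reinforces? p G γ B' ×-dec (edgeCount B' ≟ k))
... | r , witness , minimal =
  r , (γ , isγ , inj₂ (p<γ , witness , λ B' r' → minimal (edgeCount B') (B' , r' , refl))) ,
  minimal (edgeCount B) (B , reinforcesB , refl)


reinforces-by : ∀ {n p γ} (G B : Graph n) D → NonEdgesOf G B → PDominating p (G ⊕ B) D → ∣ D ∣ < γ →
                Reinforces p G γ B
reinforces-by {p = p} G B D nonEdges dom ∣D∣<γ with γ-exists p (G ⊕ B)
... | γ' , isγ'@(_ , minimal) = nonEdges , γ' , isγ' , ≤-<-trans (minimal D dom) ∣D∣<γ


pick : ∀ {n} {Q : Fin n → Set} → Dec (∃ Q) → Fin n → Bool
pick (yes (w , _)) y = y == w
pick (no _)        _ = false

pick-count : ∀ {n} {Q : Fin n → Set} (q? : Dec (∃ Q)) → count (pick q?) ≤ 1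
pick-count (yes (w , _)) = ≤-reflexive (count-singleton w)
pick-count {n} (no _)    = subst (_≤ 1) (sym (count-none n)) z≤n

pick-chosen : ∀ {n} {Q : Fin n → Set} (q? : Dec (∃ Q)) {w q} → q? ≡ yes (w , q) → pick q? w ≡ true
pick-chosen _ {w} refl = ==-refl w


-- Let D be p-dominating, v ∈ D and
-- |D| > p; put D' = D ∖ {v} and choose P ⊆ D' with |P| = p.  Join v to the
-- vertices of P it is not adjacent to, and join each vertex x ∉ D adjacent
-- to v (the only vertices losing a dominator) to one vertex of D' it is not
-- adjacent to, if there is one.  Then D' is p-dominating in the new graph,
-- and at most p + deg v edges were added.
module RemoveDominator {n} (p : ℕ) (G : Graph n) (D : Subset n) (dom : PDominating p G D)
                       (v : Fin n) (v∈D : lookup D v ≡ true) (p<∣D∣ : p < ∣ D ∣) where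

  d d' : Fin n → Bool
  d  = lookup D
  d' = d ∖ v

  D' : Subset n
  D' = tabulate d'

  d'-≢v : ∀ {y} → d' y ≡ true → y ≢ v
  d'-≢v {y} d'y refl = true≢false (∧-conicalʳ (d v) _ d'y) (cong not (==-refl v))

  d'-≢⇒d : ∀ {y} → y ≢ v → d' y ≡ d y
  d'-≢⇒d {y} y≢v = trans (cong (λ b → d y ∧ not b) (≢⇒==false y≢v)) (∧-identityʳ (d y))

  ∣D∣≡1+∣D'∣ : ∣ D ∣ ≡ suc ∣ D' ∣
  ∣D∣≡1+∣D'∣ = trans (card-count D) (trans (count-remove d v)
                 (cong₂ _+_ (cong [_] v∈D) (sym (card-tabulate d'))))

  p≤∣d'∣ : p ≤ count d'
  p≤∣d'∣ = subst (p ≤_) (card-tabulate d') (s≤s⁻¹ (subst (p <_) ∣D∣≡1+∣D'∣ p<∣D∣))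

  P : Fin n → Bool
  P = proj₁ (takeSubset d' p p≤∣d'∣)

  P⊆d' : P ⊆ᵇ d'
  P⊆d' = proj₁ (proj₂ (takeSubset d' p p≤∣d'∣))

  ∣P∣≡p : count P ≡ p
  ∣P∣≡p = proj₂ (proj₂ (takeSubset d' p p≤∣d'∣))

  W : Fin n → Bool
  W y = P y ∧ not (adj G v y)

  lost : Fin n → Bool
  lost x = not (d x) ∧ adj G x v

  replacement : ∀ x → Dec (∃ λ w → d' w ≡ true × adj G x w ≡ false)
  replacement x = any? (λ w → (d' w ≟ᵇ true) ×-dec (adj G x w ≟ᵇ false))

  H : Fin n → Fin n → Bool
  H x y = (x == v ∧ W y) ∨ (lost x ∧ pick (replacement x) y)

  B : Graph n
  B = graphOf H

  H-nonAdjacent : ∀ x y → H x y ≡ true → adj G x y ≡ false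
  H-nonAdjacent x y Hxy with ∨-elim (x == v ∧ W y) _ Hxy
  ... | inj₁ toW with ==⇒≡ x v (∧-conicalˡ (x == v) _ toW)
  ...   | refl = not-true (∧-conicalʳ (P y) _ (∧-conicalʳ (v == v) _ toW))
  H-nonAdjacent x y Hxy | inj₂ toReplacement =
    picked-nonAdjacent (replacement x) (∧-conicalʳ (lost x) _ toReplacement)
    where
    picked-nonAdjacent : (r : Dec (∃ λ w → d' w ≡ true × adj G x w ≡ false)) → pick r y ≡ true → adj G x y ≡ false
    picked-nonAdjacent (yes (w , _ , x≁w)) y==w with ==⇒≡ y w y==w
    ... | refl = x≁w

  row-bound : ∀ x → count (H x) ≤ [ x == v ] * p + [ lost x ] * 1
  row-bound x = ≤-trans (count-∨ (λ y → x == v ∧ W y) (λ y → lost x ∧ pick (replacement x) y))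
    (+-mono-≤ (count-guard (x == v) W ∣W∣≤p) (count-guard (lost x) (pick (replacement x)) (pick-count (replacement x))))
    where
    ∣W∣≤p : count W ≤ p
    ∣W∣≤p = subst (count W ≤_) ∣P∣≡p (count-mono (λ y Wy → ∧-conicalˡ (P y) _ Wy))

  ∣lost∣≤deg : count lost ≤ deg G v
  ∣lost∣≤deg = subst (count lost ≤_) (sym (card-tabulate (adj G v)))
    (count-mono (λ x lx → trans (Graph.sym G v x) (∧-conicalʳ (not (d x)) _ lx)))

  edgeCount-B : edgeCount B ≤ deg G v + p
  edgeCount-B = begin
    edgeCount B                                         ≤⟨ edgeCount-graphOf H ⟩
    pairCount H                                         ≤⟨ ∑-mono row-bound ⟩
    ∑[ x < n ] ([ x == v ] * p + [ lost x ] * 1)         ≡⟨ ∑-distrib-+ (λ x → [ x == v ] * p) (λ x → [ lost x ] * 1) ⟩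
    ∑[ x < n ] ([ x == v ] * p) + ∑[ x < n ] ([ lost x ] * 1)
                                                        ≡⟨ cong₂ _+_ (∑-*ʳ (λ x → [ x == v ]) p) (∑-*ʳ (λ x → [ lost x ]) 1) ⟩
    count (_== v) * p + count lost * 1                  ≡⟨ cong₂ _+_ (cong (_* p) (count-singleton v)) (*-identityʳ (count lost)) ⟩
    1 * p + count lost                                  ≤⟨ +-mono-≤ (≤-reflexive (*-identityˡ p)) ∣lost∣≤deg ⟩
    p + deg G v                                         ≡⟨ +-comm p (deg G v) ⟩
    deg G v + p ∎
    where open ≤-Reasoning

  reach : Fin n → Fin n → Bool
  reach x y = d' y ∧ adj (G ⊕ B) x y

  ∣reach∣ : ∀ x → ∣ D' ∩ N (G ⊕ B) x ∣ ≡ count (reach x)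
  ∣reach∣ x = trans (card-∩N D' (G ⊕ B) x)
    (count-cong (λ y → cong (_∧ adj (G ⊕ B) x y) (lookup∘tabulate d' y)))

  reach-G : ∀ {x y} → d' y ≡ true → adj G x y ≡ true → reach x y ≡ true
  reach-G {x} {y} d'y x∼y = ∧-intro d'y (∨-introˡ (adj B x y) x∼y)

  reach-H : ∀ {x y} → d' y ≡ true → x ≢ y → H x y ≡ true → reach x y ≡ true
  reach-H {x} {y} d'y x≢y Hxy = ∧-intro d'y (∨-introʳ (adj G x y) (graphOf-⊇ H x≢y Hxy))

  dominated-v : p ≤ count (reach v)
  dominated-v = subst (_≤ count (reach v)) ∣P∣≡p (count-mono P⊆reach)
    where
    P⊆reach : P ⊆ᵇ reach v
    P⊆reach y Py = by-adjacency (boolean (adj G v y))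
      where
      by-adjacency : adj G v y ≡ true ⊎ adj G v y ≡ false → reach v y ≡ true
      by-adjacency (inj₁ v∼y) = reach-G (P⊆d' y Py) v∼y
      by-adjacency (inj₂ v≁y) = reach-H (P⊆d' y Py) (λ v≡y → d'-≢v (P⊆d' y Py) (sym v≡y))
                                  (∨-introˡ _ (∧-intro (==-refl v) (∧-intro Py (cong not v≁y))))

  inD : Fin n → Fin n → Bool
  inD x y = d y ∧ adj G x y

  dominated-in-G : ∀ x → d x ≡ false → p ≤ count (inD x)
  dominated-in-G x dx = subst (p ≤_) (card-∩N D G x) (dom x (lookup⇒∉ dx))

  -- A vertex x ∉ D not adjacent to v keeps all its dominators from D.
  dominated-far : ∀ x → d x ≡ false → adj G x v ≡ false → p ≤ count (reach x)
  dominated-far x dx x≁v = ≤-trans (dominated-in-G x dx) (count-mono kept)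
    where
    kept : inD x ⊆ᵇ reach x
    kept y Dxy = reach-G (trans (d'-≢⇒d y≢v) (∧-conicalˡ (d y) _ Dxy)) (∧-conicalʳ (d y) _ Dxy)
      where
      y≢v : y ≢ v
      y≢v refl = true≢false (∧-conicalʳ (d v) _ Dxy) x≁v

  -- A vertex x ∉ D adjacent to v loses the dominator v, but its replacement
  -- w compensates; without a replacement, x is adjacent to all of D'.
  dominated-near : ∀ x → d x ≡ false → adj G x v ≡ true → p ≤ count (reach x)
  dominated-near x dx x∼v = by-replacement (replacement x) refl
    where
    by-replacement : (r : Dec (∃ λ w → d' w ≡ true × adj G x w ≡ false)) → replacement x ≡ r → p ≤ count (reach x)
    by-replacement (no none) _ = ≤-trans p≤∣d'∣ (count-mono (λ y d'y → reach-G d'y (adjacent y d'y)))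
      where
      adjacent : ∀ y → d' y ≡ true → adj G x y ≡ true
      adjacent y d'y with boolean (adj G x y)
      ... | inj₁ x∼y = x∼y
      ... | inj₂ x≁y = ⊥-elim (none (y , d'y , x≁y))
    by-replacement (yes (w , d'w , x≁w)) chosen =
      ≤-trans (dominated-in-G x dx) (≤-trans (count-exchange (inD x) v w (∧-intro v∈D x∼v) Dxw) (count-mono swapped))
      where
      Dxw : inD x w ≡ false
      Dxw = trans (cong (d w ∧_) x≁w) (∧-zeroʳ (d w))
      swapped : (λ y → (inD x ∖ v) y ∨ (y == w)) ⊆ᵇ reach x
      swapped y e with ∨-elim ((inD x ∖ v) y) (y == w) e
      ... | inj₁ Dx∖v = reach-G (∧-intro dy (∧-conicalʳ (inD x y) _ Dx∖v)) x∼y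
        where
        dy : d y ≡ true
        dy = ∧-conicalˡ (d y) _ (∧-conicalˡ (inD x y) _ Dx∖v)
        x∼y : adj G x y ≡ true
        x∼y = ∧-conicalʳ (d y) _ (∧-conicalˡ (inD x y) _ Dx∖v)
      ... | inj₂ y==w with ==⇒≡ y w y==w
      ...   | refl = reach-H d'w (λ { refl → true≢false (∧-conicalˡ (d x) _ d'w) dx })
                       (∨-introʳ (x == v ∧ W w) (∧-intro (∧-intro (cong not dx) x∼v) (pick-chosen (replacement x) chosen)))

  dominated-outside : ∀ x → d x ≡ false → p ≤ count (reach x)
  dominated-outside x dx with boolean (adj G x v)
  ... | inj₁ x∼v = dominated-near x dx x∼v
  ... | inj₂ x≁v = dominated-far x dx x≁v

  -- Hence D' is p-dominating in G ⊕ B: v is handled by P, other vertices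
  -- outside D' lie outside D.
  dominating : PDominating p (G ⊕ B) D'
  dominating x x∉D' = subst (p ≤_) (sym (∣reach∣ x)) (by-cases (x ≟ᶠ v))
    where
    d'x : d' x ≡ false
    d'x = trans (sym (lookup∘tabulate d' x)) (∉⇒lookup x∉D')
    by-cases : Dec (x ≡ v) → p ≤ count (reach x)
    by-cases (yes refl) = dominated-v
    by-cases (no x≢v) = dominated-outside x (trans (sym (d'-≢⇒d x≢v)) d'x)


remove-dominator : ∀ {n} p (G : Graph n) D → PDominating p G D → ∀ v → v ∈ D → p < ∣ D ∣ →
  ∃ λ B → NonEdgesOf G B × edgeCount B ≤ deg G v + p ×
          ∃ λ D' → PDominating p (G ⊕ B) D' × ∣ D' ∣ < ∣ D ∣
remove-dominator p G D dom v v∈D p<∣D∣ =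
  B , graphOf-nonEdges G H H-nonAdjacent , edgeCount-B , D' , dominating , ≤-reflexive (sym ∣D∣≡1+∣D'∣)
  where open RemoveDominator p G D dom v ([]=⇒lookup v∈D) p<∣D∣

low-degree-dominator : ∀ {n} p (G : Graph n) D → PDominating p G D → ∀ v → deg G v < p → v ∈ D
low-degree-dominator p G D dom v deg<p with v ∈? D
... | yes v∈D = v∈D
... | no v∉D  = ⊥-elim (<⇒≱ deg<p (≤-trans (dom v v∉D) (p⊆q⇒∣p∣≤∣q∣ (p∩q⊆q D (N G v)))))

corollary5p2 : ∀ {n} (p : ℕ) (G : Graph n) → 1 ≤ p → HasEdge G →
    ∀ δ → IsMinDegree G δ → δ < p →
    ∃ λ r → IsReinfP p G r × r ≤ δ + p
corollary5p2 p G _ _ _ ((v , refl) , _) deg<p with γ-exists p G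
... | _ , isγ@((D , dom , refl) , _) with ∣ D ∣ ≤? p
...   | yes γ≤p = 0 , (∣ D ∣ , isγ , inj₁ (γ≤p , refl)) , z≤n
...   | no γ≰p with remove-dominator p G D dom v (low-degree-dominator p G D dom v deg<p) (≰⇒> γ≰p)
...     | B , nonEdges , ∣B∣≤deg+p , D' , dom' , ∣D'∣<∣D∣ =
  let r , isr , r≤∣B∣ = reinforcement-bound p G ∣ D ∣ isγ (≰⇒> γ≰p) B
                          (reinforces-by G B D' nonEdges dom' ∣D'∣<∣D∣)
  in  r , isr , ≤-trans r≤∣B∣ ∣B∣≤deg+p
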